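{- Let $M_0$ and $M_1$ be finite Kripke models of the form described in the context, with roots $x_0$ and $x_1$ respectively, and let $P^+,P^-$ be finite sets of propositional variables. If $(M_0,x_0)\xrightarrow[3]{(P^+,P^-)}(M_1,x_1)$, then (1) for every cluster $C_0$ of final elements of $M_0$ there is a cluster $C_1$ of final elements of $M_1$ such that $C_0$ matches $C_1$, and (2) for every cluster $C_1$ of final elements of $M_1$ there is a cluster $C_0$ of final elements of $M_0$ such that $C_0$ matches $C_1$.
   Context: Modal formulas use variables, $\bot,\land,\lor,\neg,\to,\Box$ ($\Diamond=\neg\Box\neg$); $v^+(\varphi),v^-(\varphi)$ are the variables occurring positively/negatively ($\neg$ and the antecedent of $\to$ swap polarity, $\Box$, $\land$, $\lor$ preserve it, $v^+(p)=\{p\}$, $v^-(p)=\emptyset$); $d(\varphi)$ is the modal depth. Kripke frames have reflexive transitive $R$. A cluster is an equivalence class of $xR^sy:\iff xRy\wedge yRx$; $y$ is final if $yRz$ implies $zRy$. Each $M_i=(W_i,R_i,\Vdash_i)$ ($i\in\{0,1\}$) is a finite model with a root $x_i$ ($x_iRy$ for all $y$) such that $W_i\setminus\{x_i\}$ is the disjoint union of finitely many (at least one) clusters of final elements, each element of a cluster seeing exactly the elements of its cluster. A $(P^+,P^-)$-formula is one with $v^\circ(\varphi)\subseteq P^\circ$ for $\circ\in\{+,-\}$. $(M_0,w_0)\xrightarrow[n]{(P^+,P^-)}(M_1,w_1)$ means every $(P^+,P^-)$-formula of modal depth $\le n$ true at $(M_0,w_0)$ is true at $(M_1,w_1)$.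 A cluster $C_0$ of $M_0$ matches a cluster $C_1$ of $M_1$ iff for every $u_0\in C_0$ there is $u_1\in C_1$ with $(M_0,u_0)\xrightarrow[0]{(P^+,P^-)}(M_1,u_1)$, and for every $u_1\in C_1$ there is $u_0\in C_0$ with $(M_0,u_0)\xrightarrow[0]{(P^+,P^-)}(M_1,u_1)$. -}

module Defs where

open import Data.Nat using (ℕ; zero; suc; _⊔_; _≤_)
open import Data.Bool using (Bool; true; false; T)
open import Data.Fin using (Fin)
open import Data.List using (List; []; _∷_; _++_)
open import Data.List.Membership.Propositional using (_∈_)
open import Data.List.Relation.Unary.All using (All)
open import Data.Product using (Σ; ∃; ∃-syntax; _×_; _,_)
open import Data.Sum using (_⊎_)
open import Data.Empty using (⊥)
open import Relation.Nullary using (¬_)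
open import Relation.Binary using (Decidable)
open import Relation.Binary.PropositionalEquality using (_≡_; _≢_)

Var : Set
Var = ℕ

data Form : Set where
  var  : Var → Form
  bot  : Form
  _∧′_ : Form → Form → Form
  _∨′_ : Form → Form → Form
  ¬′_  : Form → Form
  _⇒_  : Form → Form → Form
  □_   : Form → Form

mutual
  vpos : Form → List Var
  vpos (var p)   = p ∷ []
  vpos bot       = []
  vpos (φ ∧′ ψ)  = vpos φ ++ vpos ψ
  vpos (φ ∨′ ψ)  = vpos φ ++ vpos ψ
  vpos (¬′ φ)    = vneg φ
  vpos (φ ⇒ ψ)   = vneg φ ++ vpos ψ
  vpos (□ φ)     = vpos φ

  vneg : Form → List Var
  vneg (var p)   = []
  vneg bot       = []
  vneg (φ ∧′ ψ)  = vneg φ ++ vneg ψ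
  vneg (φ ∨′ ψ)  = vneg φ ++ vneg ψ
  vneg (¬′ φ)    = vpos φ
  vneg (φ ⇒ ψ)   = vpos φ ++ vneg ψ
  vneg (□ φ)     = vneg φ

depth : Form → ℕ
depth (var p)  = 0
depth bot      = 0
depth (φ ∧′ ψ) = depth φ ⊔ depth ψ
depth (φ ∨′ ψ) = depth φ ⊔ depth ψ
depth (¬′ φ)   = depth φ
depth (φ ⇒ ψ)  = depth φ ⊔ depth ψ
depth (□ φ)    = suc (depth φ)

PPFormula : List Var → List Var → Form → Set
PPFormula P⁺ P⁻ φ = All (_∈ P⁺) (vpos φ) × All (_∈ P⁻) (vneg φ)

-- Finite rooted Kripke model of the shape in the context:
-- carrier Fin size, R reflexive and transitive, a root seeing everything,
-- and W∖{root} a (nonempty) disjoint union of clusters of final elements,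
-- each element of which sees exactly the elements of its own cluster.
record Model : Set₁ where
  field
    size     : ℕ
    R        : Fin size → Fin size → Set
    R?       : Decidable R
    val      : Var → Fin size → Bool
    R-refl   : ∀ x → R x x
    R-trans  : ∀ x y z → R x y → R y z → R x z
    root     : Fin size
    root-sees : ∀ y → R root y
    nonempty : ∃[ y ] (y ≢ root)
    nonroot-final : ∀ y → y ≢ root → ∀ z → R y z → R z y
    nonroot-not-root : ∀ y → y ≢ root → ¬ R y root

open Model public

_,_⊩_ : (M : Model) → Fin (size M) → Form → Set
M , w ⊩ var p   = T (val M p w)
M , w ⊩ bot     = ⊥
M , w ⊩ (φ ∧′ ψ) = (M , w ⊩ φ) × (M , w ⊩ ψ)
M , w ⊩ (φ ∨′ ψ) = (M , w ⊩ φ) ⊎ (M , w ⊩ ψ)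
M , w ⊩ (¬′ φ)  = ¬ (M , w ⊩ φ)
M , w ⊩ (φ ⇒ ψ) = (M , w ⊩ φ) → (M , w ⊩ ψ)
M , w ⊩ (□ φ)   = ∀ v → R M w v → M , v ⊩ φ

Preserves : List Var → List Var → ℕ →
            (M₀ : Model) → Fin (size M₀) → (M₁ : Model) → Fin (size M₁) → Set
Preserves P⁺ P⁻ n M₀ w₀ M₁ w₁ =
  ∀ φ → PPFormula P⁺ P⁻ φ → depth φ ≤ n → M₀ , w₀ ⊩ φ → M₁ , w₁ ⊩ φ

Rs : (M : Model) → Fin (size M) → Fin (size M) → Set
Rs M x y = R M x y × R M y x

Final : (M : Model) → Fin (size M) → Set
Final M y = ∀ z → R M y z → R M z y

Subset : Model → Set₁
Subset M = Fin (size M) → Set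

IsFinalCluster : (M : Model) → Subset M → Set
IsFinalCluster M C =
  ∃[ u ] (Final M u × (∀ v → (C v → Rs M u v) × (Rs M u v → C v)))

Matches : List Var → List Var → (M₀ M₁ : Model) → Subset M₀ → Subset M₁ → Set
Matches P⁺ P⁻ M₀ M₁ C₀ C₁ =
  (∀ u₀ → C₀ u₀ → ∃[ u₁ ] (C₁ u₁ × Preserves P⁺ P⁻ 0 M₀ u₀ M₁ u₁)) ×
  (∀ u₁ → C₁ u₁ → ∃[ u₀ ] (C₀ u₀ × Preserves P⁺ P⁻ 0 M₀ u₀ M₁ u₁))

{-# OPTIONS --safe #-}
module Submission where

-- For a point c write χ c for its (P⁺,P⁻)-type: the conjunction of the p ∈ P⁺ true at c and of
-- the ¬ p for p ∈ P⁻ false at c, so that χ c holding at v means (M₀,c) →₀ (M₁,v). If C is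
-- the cluster of a final point u of M₀, the depth-3 formula ◇□(⋁_{c∈C} χ c ∧ ⋀_{c∈C} ◇ χ c)
-- holds at x₀, hence at x₁. As every point of M₁ sees a final one, its □-part then holds at a
-- final point w of M₁, and it says precisely that the cluster of w matches C; this is (1).
-- For (2), build the formula in M₁ with P⁺ and P⁻ exchanged: its negation is a (P⁺,P⁻)-formula,
-- so, forcing being decidable, the formula is reflected from x₁ to x₀ and (1) applies backwards.

open import Defs
open import Data.List using (List)
open import Data.Product using (_×_; ∃-syntax)

open import Data.Bool using (Bool; true; false; T)
open import Data.Fin using (Fin; _≟_)
open import Data.Fin.Properties using (all?; any?)
open import Data.List using ([]; _∷_; filter; allFin)
open import Data.List.Membership.Propositional using (_∈_; find; lose)
open import Data.List.Membership.Propositional.Properties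
  using (∈-filter⁺; ∈-filter⁻; ∈-allFin)
open import Data.List.Relation.Unary.All as All using (All; []; _∷_)
open import Data.List.Relation.Unary.All.Properties using (++⁺; ++⁻)
open import Data.List.Relation.Unary.Any using (Any; toSum; fromSum)
open import Data.Nat using (ℕ; suc; _≤_; z≤n; s≤s)
open import Data.Nat.Properties using (≤-trans; ⊔-lub; m⊔n≤o⇒m≤o; m⊔n≤o⇒n≤o)
open import Data.Product using (_,_; proj₁; proj₂; swap; map₂)
open import Data.Sum using () renaming (map to ⊎-map; map₂ to ⊎-map₂)
open import Function using (_∘_; id)
open import Function.Bundles using (_⇔_; mk⇔; module Equivalence)
open import Relation.Nullary using (Dec; yes; no)
open import Relation.Nullary.Decidable
  using (T?; ¬?; _×-dec_; _⊎-dec_; _→-dec_; decidable-stable)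
open import Relation.Binary.PropositionalEquality using (refl)

open Equivalence using (to; from)

private
  variable
    X : Set
    xs : List X
    f : X → Form
    A B : List Var
    p : Var
    m n : ℕ
    φ ψ : Form
    M₀ M₁ : Model

⊤′ : Form
⊤′ = bot ⇒ bot

◇ : Form → Form
◇ φ = ¬′ (□ (¬′ φ))

⋀ : List X → (X → Form) → Form
⋀ []       f = ⊤′
⋀ (x ∷ xs) f = f x ∧′ ⋀ xs f

⋁ : List X → (X → Form) → Form
⋁ []       f = bot
⋁ (x ∷ xs) f = f x ∨′ ⋁ xs f

record Admissible (A B : List Var) (n : ℕ) (φ : Form) : Set where
  constructor _,_
  field
    polarities : PPFormula A B φ
    depth≤     : depth φ ≤ n

adm-⊤ : Admissible A B n ⊤′
adm-⊤ = ([] , []) , z≤n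

adm-⊥ : Admissible A B n bot
adm-⊥ = ([] , []) , z≤n

adm-∧ : Admissible A B n φ → Admissible A B n ψ → Admissible A B n (φ ∧′ ψ)
adm-∧ ((p , q) , d) ((p′ , q′) , d′) = (++⁺ p p′ , ++⁺ q q′) , ⊔-lub d d′

adm-∨ : Admissible A B n φ → Admissible A B n ψ → Admissible A B n (φ ∨′ ψ)
adm-∨ ((p , q) , d) ((p′ , q′) , d′) = (++⁺ p p′ , ++⁺ q q′) , ⊔-lub d d′

adm-¬ : Admissible B A n φ → Admissible A B n (¬′ φ)
adm-¬ ((p , q) , d) = (q , p) , d

adm-□ : Admissible A B n φ → Admissible A B (suc n) (□ φ)
adm-□ (pq , d) = pq , s≤s d

adm-◇ : Admissible A B n φ → Admissible A B (suc n) (◇ φ)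
adm-◇ = adm-¬ ∘ adm-□ ∘ adm-¬

adm-≤ : m ≤ n → Admissible A B m φ → Admissible A B n φ
adm-≤ m≤n (pq , d) = pq , ≤-trans d m≤n

adm-⋀ : All (Admissible A B n ∘ f) xs → Admissible A B n (⋀ xs f)
adm-⋀ []       = adm-⊤
adm-⋀ (a ∷ as) = adm-∧ a (adm-⋀ as)

adm-⋁ : All (Admissible A B n ∘ f) xs → Admissible A B n (⋁ xs f)
adm-⋁ []       = adm-⊥
adm-⋁ (a ∷ as) = adm-∨ a (adm-⋁ as)

adm-∧⁻ : Admissible A B n (φ ∧′ ψ) → Admissible A B n φ × Admissible A B n ψ
adm-∧⁻ {φ = φ} {ψ = ψ} ((p , q) , d) =
  let pφ , pψ = ++⁻ (vpos φ) p
      qφ , qψ = ++⁻ (vneg φ) q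
  in ((pφ , qφ) , m⊔n≤o⇒m≤o (depth φ) (depth ψ) d) ,
     ((pψ , qψ) , m⊔n≤o⇒n≤o (depth φ) (depth ψ) d)

adm-∨⁻ : Admissible A B n (φ ∨′ ψ) → Admissible A B n φ × Admissible A B n ψ
adm-∨⁻ {φ = φ} {ψ = ψ} ((p , q) , d) =
  let pφ , pψ = ++⁻ (vpos φ) p
      qφ , qψ = ++⁻ (vneg φ) q
  in ((pφ , qφ) , m⊔n≤o⇒m≤o (depth φ) (depth ψ) d) ,
     ((pψ , qψ) , m⊔n≤o⇒n≤o (depth φ) (depth ψ) d)

adm-¬⁻ : Admissible A B n (¬′ φ) → Admissible B A n φ
adm-¬⁻ ((p , q) , d) = (q , p) , d

adm-⇒⁻ : Admissible A B n (φ ⇒ ψ) → Admissible B A n φ × Admissible A B n ψ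
adm-⇒⁻ {φ = φ} {ψ = ψ} ((p , q) , d) =
  let pφ , pψ = ++⁻ (vneg φ) p
      qφ , qψ = ++⁻ (vpos φ) q
  in ((qφ , pφ) , m⊔n≤o⇒m≤o (depth φ) (depth ψ) d) ,
     ((pψ , qψ) , m⊔n≤o⇒n≤o (depth φ) (depth ψ) d)

record AtomPreserves (A B : List Var) (M₀ : Model) (w₀ : Fin (size M₀))
                     (M₁ : Model) (w₁ : Fin (size M₁)) : Set where
  constructor _,_
  field
    positive : All (λ p → T (val M₀ p w₀) → T (val M₁ p w₁)) A
    negative : All (λ p → T (val M₁ p w₁) → T (val M₀ p w₀)) B

AtomPreserves-dual : ∀ {w₀ w₁} →
                     AtomPreserves A B M₀ w₀ M₁ w₁ → AtomPreserves B A M₁ w₁ M₀ w₀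
AtomPreserves-dual (h⁺ , h⁻) = h⁻ , h⁺

AtomPreserves⇒⊩ : ∀ {w₀ w₁} → AtomPreserves A B M₀ w₀ M₁ w₁ →
                  ∀ φ → Admissible A B 0 φ → M₀ , w₀ ⊩ φ → M₁ , w₁ ⊩ φ
AtomPreserves⇒⊩ (h⁺ , _) (var p) ((p∈A ∷ [] , _) , _) = All.lookup h⁺ p∈A
AtomPreserves⇒⊩ h (φ ∧′ ψ) a (x , y) =
  let aφ , aψ = adm-∧⁻ a
  in AtomPreserves⇒⊩ h φ aφ x , AtomPreserves⇒⊩ h ψ aψ y
AtomPreserves⇒⊩ h (φ ∨′ ψ) a =
  let aφ , aψ = adm-∨⁻ a
  in ⊎-map (AtomPreserves⇒⊩ h φ aφ) (AtomPreserves⇒⊩ h ψ aψ)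
AtomPreserves⇒⊩ h (¬′ φ) a ¬x y =
  ¬x (AtomPreserves⇒⊩ (AtomPreserves-dual h) φ (adm-¬⁻ a) y)
AtomPreserves⇒⊩ h (φ ⇒ ψ) a x⇒y x =
  let aφ , aψ = adm-⇒⁻ a
  in AtomPreserves⇒⊩ h ψ aψ (x⇒y (AtomPreserves⇒⊩ (AtomPreserves-dual h) φ aφ x))
AtomPreserves⇒⊩ _ (□ φ) (_ , ())

_,_⊩?_ : (M : Model) (w : Fin (size M)) (φ : Form) → Dec (M , w ⊩ φ)
M , w ⊩? var p    = T? (val M p w)
M , w ⊩? bot      = no id
M , w ⊩? (φ ∧′ ψ) = (M , w ⊩? φ) ×-dec (M , w ⊩? ψ)
M , w ⊩? (φ ∨′ ψ) = (M , w ⊩? φ) ⊎-dec (M , w ⊩? ψ)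
M , w ⊩? (¬′ φ)   = ¬? (M , w ⊩? φ)
M , w ⊩? (φ ⇒ ψ)  = (M , w ⊩? φ) →-dec (M , w ⊩? ψ)
M , w ⊩? (□ φ)    = all? (λ v → R? M w v →-dec (M , v ⊩? φ))

Preserves-dual : ∀ {w₀ w₁} → Preserves A B n M₀ w₀ M₁ w₁ → Preserves B A n M₁ w₁ M₀ w₀
Preserves-dual {M₀ = M₀} {w₀ = w₀} pres φ pp d w₁⊩φ =
  decidable-stable (M₀ , w₀ ⊩? φ) λ w₀⊮φ → pres (¬′ φ) (swap pp) d w₀⊮φ w₁⊩φ

Matches-dual : ∀ {C₀ C₁} → Matches A B M₀ M₁ C₀ C₁ → Matches B A M₁ M₀ C₁ C₀
Matches-dual (forth , back) =
  (λ u₁ C₁u₁ → let u₀ , C₀u₀ , pres = back u₁ C₁u₁ in u₀ , C₀u₀ , Preserves-dual pres) ,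
  (λ u₀ C₀u₀ → let u₁ , C₁u₁ , pres = forth u₀ C₀u₀ in u₁ , C₁u₁ , Preserves-dual pres)

◇-intro : ∀ M {w v} φ → R M w v → M , v ⊩ φ → M , w ⊩ ◇ φ
◇-intro M φ wRv v⊩φ w⊩□¬φ = w⊩□¬φ _ wRv v⊩φ

◇-elim : ∀ M {w} φ → M , w ⊩ ◇ φ → ∃[ v ] (R M w v × M , v ⊩ φ)
◇-elim M {w} φ w⊩◇φ =
  decidable-stable (any? λ v → R? M w v ×-dec (M , v ⊩? φ))
                   λ ∄v → w⊩◇φ λ v wRv v⊩φ → ∄v (v , wRv , v⊩φ)

⊩-⋀ : ∀ M {w} (xs : List X) (f : X → Form) →
      M , w ⊩ ⋀ xs f ⇔ All (λ x → M , w ⊩ f x) xs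
⊩-⋀ M []       f = mk⇔ (λ _ → []) (λ _ → id)
⊩-⋀ M (x ∷ xs) f = mk⇔ (λ (h , hs) → h ∷ to (⊩-⋀ M xs f) hs)
                       (λ { (h ∷ hs) → h , from (⊩-⋀ M xs f) hs })

⊩-⋁ : ∀ M {w} (xs : List X) (f : X → Form) →
      M , w ⊩ ⋁ xs f ⇔ Any (λ x → M , w ⊩ f x) xs
⊩-⋁ M []       f = mk⇔ (λ ()) (λ ())
⊩-⋁ M (x ∷ xs) f = mk⇔ (fromSum ∘ ⊎-map₂ (to (⊩-⋁ M xs f)))
                       (⊎-map₂ (from (⊩-⋁ M xs f)) ∘ toSum)

lit⁺ : Bool → Var → Form
lit⁺ true  p = var p
lit⁺ false p = ⊤′

lit⁻ : Bool → Var → Form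
lit⁻ true  p = ⊤′
lit⁻ false p = ¬′ var p

⊩-lit⁺ : ∀ M {v} b → M , v ⊩ lit⁺ b p ⇔ (T b → T (val M p v))
⊩-lit⁺ M true  = mk⇔ (λ h _ → h) (λ h → h _)
⊩-lit⁺ M false = mk⇔ (λ _ ()) (λ _ → id)

⊩-lit⁻ : ∀ M {v} b → M , v ⊩ lit⁻ b p ⇔ (T (val M p v) → T b)
⊩-lit⁻ M true  = mk⇔ _ (λ _ → id)
⊩-lit⁻ M false = mk⇔ id id

adm-lit⁺ : ∀ b → p ∈ A → Admissible A B 0 (lit⁺ b p)
adm-lit⁺ true  p∈A = (p∈A ∷ [] , []) , z≤n
adm-lit⁺ false _   = adm-⊤

adm-lit⁻ : ∀ b → p ∈ B → Admissible A B 0 (lit⁻ b p)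
adm-lit⁻ true  _   = adm-⊤
adm-lit⁻ false p∈B = ([] , p∈B ∷ []) , z≤n

χ : List Var → List Var → (M : Model) → Fin (size M) → Form
χ A B M c = ⋀ A (λ p → lit⁺ (val M p c) p) ∧′ ⋀ B (λ p → lit⁻ (val M p c) p)

adm-χ : ∀ M {c} → Admissible A B 0 (χ A B M c)
adm-χ M = adm-∧ (adm-⋀ (All.tabulate (adm-lit⁺ _))) (adm-⋀ (All.tabulate (adm-lit⁻ _)))

⊩-χ : ∀ A B M₀ M₁ {c v} → M₁ , v ⊩ χ A B M₀ c ⇔ AtomPreserves A B M₀ c M₁ v
⊩-χ A B M₀ M₁ = mk⇔
  (λ (h⁺ , h⁻) → All.map (to (⊩-lit⁺ M₁ _)) (to (⊩-⋀ M₁ A _) h⁺) ,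
                 All.map (to (⊩-lit⁻ M₁ _)) (to (⊩-⋀ M₁ B _) h⁻))
  (λ (a⁺ , a⁻) → from (⊩-⋀ M₁ A _) (All.map (from (⊩-lit⁺ M₁ _)) a⁺) ,
                 from (⊩-⋀ M₁ B _) (All.map (from (⊩-lit⁻ M₁ _)) a⁻))

χ-self : ∀ A B M c → M , c ⊩ χ A B M c
χ-self A B M c =
  from (⊩-χ A B M M) (All.universal (λ _ → id) A , All.universal (λ _ → id) B)

χ-sound : ∀ M₀ M₁ {c v} → M₁ , v ⊩ χ A B M₀ c → Preserves A B 0 M₀ c M₁ v
χ-sound {A = A} {B = B} M₀ M₁ v⊩χ φ pp d =
  AtomPreserves⇒⊩ (to (⊩-χ A B M₀ M₁) v⊩χ) φ (pp , d)

sees-final : (M : Model) (w : Fin (size M)) → ∃[ v ] (R M w v × Final M v)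
sees-final M w with w ≟ root M
... | yes refl = let v , v≢root = nonempty M in v , root-sees M v , nonroot-final M v v≢root
... | no w≢root = w , R-refl M w , nonroot-final M w w≢root

□-up : ∀ M {w v} φ → R M w v → M , w ⊩ (□ φ) → M , v ⊩ (□ φ)
□-up M {w} {v} φ wRv w⊩□φ u vRu = w⊩□φ u (R-trans M w v u wRv vRu)

◇□-root⇒final : ∀ M φ → M , root M ⊩ ◇ (□ φ) → ∃[ w ] (Final M w × M , w ⊩ (□ φ))
◇□-root⇒final M φ h =
  let v , _ , v⊩□φ = ◇-elim M (□ φ) h
      w , vRw , w-final = sees-final M v
  in w , w-final , □-up M φ vRw v⊩□φ

successors : (M : Model) → Fin (size M) → List (Fin (size M))
successors M u = filter (R? M u) (allFin (size M))

∈-successors⁺ : ∀ M {u v} → R M u v → v ∈ successors M u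
∈-successors⁺ M {u} = ∈-filter⁺ (R? M u) (∈-allFin _)

∈-successors⁻ : ∀ M {u v} → v ∈ successors M u → R M u v
∈-successors⁻ M {u} = proj₂ ∘ ∈-filter⁻ (R? M u) {xs = allFin (size M)}

clusterBody : List Var → List Var → (M : Model) → Fin (size M) → Form
clusterBody A B M u = ⋁ (successors M u) (χ A B M) ∧′ ⋀ (successors M u) (◇ ∘ χ A B M)

adm-◇□clusterBody : ∀ A B M u → Admissible A B 3 (◇ (□ (clusterBody A B M u)))
adm-◇□clusterBody A B M u =
  adm-◇ (adm-□ (adm-∧ (adm-⋁ (All.universal (λ _ → adm-≤ z≤n (adm-χ M)) _))
                      (adm-⋀ (All.universal (λ _ → adm-◇ (adm-χ M)) _))))

◇□clusterBody-root : ∀ A B M {u} → Final M u → M , root M ⊩ ◇ (□ (clusterBody A B M u))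
◇□clusterBody-root A B M {u} u-final =
  ◇-intro M (□ (clusterBody A B M u)) (root-sees M u) body
  where
  body : ∀ v → R M u v → M , v ⊩ clusterBody A B M u
  body v uRv =
    from (⊩-⋁ M (successors M u) (χ A B M))
         (lose (∈-successors⁺ M uRv) (χ-self A B M v)) ,
    from (⊩-⋀ M (successors M u) (◇ ∘ χ A B M)) (All.tabulate λ {c} c∈ →
      ◇-intro M (χ A B M c) (R-trans M v u c (u-final v uRv) (∈-successors⁻ M c∈))
              (χ-self A B M c))

□clusterBody⇒Matches :
  ∀ {A B} M₀ M₁ {u w} {C : Subset M₀} → (∀ c → (C c → Rs M₀ u c) × (Rs M₀ u c → C c)) →
  Final M₀ u → Final M₁ w → M₁ , w ⊩ (□ (clusterBody A B M₀ u)) →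
  Matches A B M₀ M₁ C (Rs M₁ w)
□clusterBody⇒Matches {A} {B} M₀ M₁ {u} {w} {C} C≐ u-final w-final w⊩□body = forth , back
  where
  forth : ∀ c → C c → ∃[ v ] (Rs M₁ w v × Preserves A B 0 M₀ c M₁ v)
  forth c Cc =
    let uRc , _ = proj₁ (C≐ c) Cc
        w⊩◇χs = to (⊩-⋀ M₁ (successors M₀ u) (◇ ∘ χ A B M₀))
                   (proj₂ (w⊩□body w (R-refl M₁ w)))
        v , wRv , v⊩χ = ◇-elim M₁ (χ A B M₀ c) (All.lookup w⊩◇χs (∈-successors⁺ M₀ uRc))
    in v , (wRv , w-final v wRv) , χ-sound M₀ M₁ v⊩χ

  back : ∀ v → Rs M₁ w v → ∃[ c ] (C c × Preserves A B 0 M₀ c M₁ v)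
  back v (wRv , _) =
    let c , c∈ , v⊩χ = find (to (⊩-⋁ M₁ (successors M₀ u) (χ A B M₀))
                                (proj₁ (w⊩□body v wRv)))
        uRc = ∈-successors⁻ M₀ c∈
    in c , proj₂ (C≐ c) (uRc , u-final c uRc) , χ-sound M₀ M₁ v⊩χ

finalCluster-matched :
  ∀ {A B} M₀ M₁ → Preserves A B 3 M₀ (root M₀) M₁ (root M₁) →
  (C₀ : Subset M₀) → IsFinalCluster M₀ C₀ →
  ∃[ C₁ ] (IsFinalCluster M₁ C₁ × Matches A B M₀ M₁ C₀ C₁)
finalCluster-matched {A} {B} M₀ M₁ pres C₀ (u , u-final , C₀≐) =
  let body = clusterBody A B M₀ u
      pp , d = adm-◇□clusterBody A B M₀ u
      w , w-final , w⊩□body =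
        ◇□-root⇒final M₁ body (pres (◇ (□ body)) pp d (◇□clusterBody-root A B M₀ u-final))
  in Rs M₁ w , (w , w-final , λ _ → id , id) ,
     □clusterBody⇒Matches M₀ M₁ C₀≐ u-final w-final w⊩□body

lemma4p4 : (M₀ M₁ : Model) (P⁺ P⁻ : List Var) →
    Preserves P⁺ P⁻ 3 M₀ (root M₀) M₁ (root M₁) →
    ((C₀ : Subset M₀) → IsFinalCluster M₀ C₀ →
      ∃[ C₁ ] (IsFinalCluster M₁ C₁ × Matches P⁺ P⁻ M₀ M₁ C₀ C₁)) ×
    ((C₁ : Subset M₁) → IsFinalCluster M₁ C₁ →
      ∃[ C₀ ] (IsFinalCluster M₀ C₀ × Matches P⁺ P⁻ M₀ M₁ C₀ C₁))
lemma4p4 M₀ M₁ P⁺ P⁻ pres =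
  finalCluster-matched M₀ M₁ pres ,
  λ C₁ C₁-final →
    map₂ (map₂ Matches-dual) (finalCluster-matched M₁ M₀ (Preserves-dual pres) C₁ C₁-final)
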